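{- Let $G$ be an embedded simple graph whose dual is a simple graph, and let $V_c$ be a cutset of $G$. If $G_b$ (with the embedding induced from $\bar G_b$) has a face $f$ of size $2$, then there is exactly one component $C$ of $G-V_c$ inside $f$, and (whether $f$ is bridged or not) $F_C\ne\emptyset$.
   Context: An embedded graph is a connected graph with a combinatorial embedding in an orientable surface: each edge $\{v,w\}$ gives directed edges $(v,w),(w,v)$, each vertex has a cyclic rotational order of its outgoing directed edges, and faces are the cyclic sequences $(v_0,v_1),\dots,(v_{k-1},v_0)$ of pairwise different directed edges with $(v_{i+1},v_{i+2})$ following $(v_{i+1},v_i)$ at $v_{i+1}$; the size of a face is its number of directed edges. The dual has the faces as vertices and one edge per edge of $G$, joining the faces containing its two directed edges. For a cutset $V_c$: $F_b$ (boundary faces) is the set of faces $(v_0,v_1),\dots,(v_{k-1},v_0)$ with indices $0\le i<j\le k-1$ such that $v_i,v_j\in V_c$ ($v_i=v_j$ allowed); for a component $C$ of $G-V_c$, $F_C$ is the set of faces not in $F_b$ whose boundary vertices all lie in $C\cup V_c$. The boundary multigraph $G_b$ is the bipartite multigraph on $V_c\cup F_b$ with one edge $\{v,f\}$ for each occurrence of $v\in V_c$ in the boundary walk of $f\in F_b$. The graph $\bar G_b=G\cup G_b$ is embedded so that at each $v\in V_c$ the edges to $F_b$ are placed in the angles of the corresponding faces (inside those faces) and the rotation at $f\in F_b$ follows its boundary walk; $G_b$ carries the induced embedding. A component $C$ is inside a face of $G_b$ if some edge from $C$ to $V_c$ lies in an angle of that face in $\bar G_b$. A face of $G_b$ is bridged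 if some $G_b$-bridge of $\bar G_b$ inside it is also inside another face of $G_b$ (bridges being single edges not in $G_b$ with both ends in $G_b$, or components of $\bar G_b-V(G_b)$ with their attaching edges). -}

module Defs where

open import Data.Nat using (ℕ; zero; suc; _<_)
open import Data.Nat.DivMod using (_%_; m%n<n)
open import Data.Fin using (Fin; toℕ; fromℕ<)
open import Data.Fin.Subset using (Subset; _∈_; _∉_)
open import Data.Product using (Σ; ∃; _×_; _,_)
open import Data.Sum using (_⊎_)
open import Data.Unit using (⊤)
open import Data.Empty using (⊥)
open import Relation.Nullary using (¬_)
open import Relation.Binary.PropositionalEquality using (_≡_; _≢_)

iter : {A : Set} → (A → A) → ℕ → A → A
iter f zero    a = a
iter f (suc k) a = f (iter f k a)

cycSucc : {k : ℕ} → Fin k → Fin k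
cycSucc {suc k} i = fromℕ< (m%n<n (suc (toℕ i)) (suc k))

-- Directed edges (darts): Fin d.
-- A dart x is the directed edge (tail x , head x); rev x is the opposite
-- directed edge of the same edge; rot x is the dart following x in the
-- cyclic rotational order at tail x.

record EmbeddedGraph : Set where
  field
    n d  : ℕ
    tail : Fin d → Fin n
    rev  : Fin d → Fin d
    rot  : Fin d → Fin d

  head : Fin d → Fin n
  head x = tail (rev x)

  data Walk (P : Fin n → Set) : Fin n → Fin n → Set where
    here : ∀ {u} → P u → Walk P u u
    step : ∀ {v} (x : Fin d) → P (tail x) → Walk P (head x) v → Walk P (tail x) v

  -- following directed edge along a face: (v_{i+1},v_{i+2}) follows
  -- (v_{i+1},v_i) at v_{i+1}
  fnext : Fin d → Fin d
  fnext x = rot (rev x)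

  SameFace : Fin d → Fin d → Set
  SameFace x y = ∃ λ k → iter fnext k x ≡ y

open EmbeddedGraph public

record IsEmbeddedGraph (G : EmbeddedGraph) : Set where
  field
    rev-invol : ∀ x → rev G (rev G x) ≡ x
    rev-nofix : ∀ x → rev G x ≢ x
    rot-inj   : ∀ x y → rot G x ≡ rot G y → x ≡ y
    rot-tail  : ∀ x → tail G (rot G x) ≡ tail G x
    rot-cycle : ∀ x y → tail G x ≡ tail G y → ∃ λ k → iter (rot G) k x ≡ y
    connected : ∀ u v → Walk G (λ _ → ⊤) u v

SimpleGraph : EmbeddedGraph → Set
SimpleGraph G =
  (∀ x → tail G x ≢ head G x) ×
  (∀ x y → tail G x ≡ tail G y → head G x ≡ head G y → x ≡ y)

-- The dual is simple: the dual edge of {x, rev x} joins the face of x and the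
-- face of rev x; no loops and no two distinct edges with the same end faces.
DualSimple : EmbeddedGraph → Set
DualSimple G =
  (∀ x → ¬ SameFace G x (rev G x)) ×
  (∀ x y → SameFace G x y → SameFace G (rev G x) (rev G y) → x ≡ y)

module _ (G : EmbeddedGraph) (Vc : Subset (n G)) where

  ReachOut : Fin (n G) → Fin (n G) → Set
  ReachOut = Walk G (λ u → u ∉ Vc)

  Cutset : Set
  Cutset = ∃ λ u → ∃ λ v → u ∉ Vc × v ∉ Vc × ¬ ReachOut u v

  -- the face of dart x is a boundary face (in F_b): its boundary walk has two
  -- different positions whose vertices lie in V_c
  InFb : Fin (d G) → Set
  InFb x = ∃ λ y → ∃ λ z → SameFace G x y × SameFace G x z × y ≢ z
           × tail G y ∈ Vc × tail G z ∈ Vc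

  -- an occurrence of a vertex of V_c in the boundary walk of a face of F_b;
  -- these are exactly the edges of the boundary multigraph G_b
  BOcc : Fin (d G) → Set
  BOcc x = tail G x ∈ Vc × InFb x

  NextOcc : Fin (d G) → Fin (d G) → Set
  NextOcc x y = ∃ λ k → iter (fnext G) (suc k) x ≡ y × tail G y ∈ Vc
                × (∀ i → i < k → tail G (iter (fnext G) (suc i) x) ∉ Vc)

  NextRotOcc : Fin (d G) → Fin (d G) → Set
  NextRotOcc x y = ∃ λ k → iter (rot G) (suc k) x ≡ y × BOcc y
                   × (∀ i → i < k → ¬ BOcc (iter (rot G) (suc i) x))

  -- darts of G_b: for an occurrence x, vf x goes from tail x to the face of x,
  -- fv x goes from the face of x to tail x
  data BDart : Set where
    vf : Fin (d G) → BDart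
    fv : Fin (d G) → BDart

  revB : BDart → BDart
  revB (vf x) = fv x
  revB (fv x) = vf x

  -- At v ∈ V_c the G_b-edge of
  -- occurrence x sits in the angle just before x, so the induced rotation is
  -- the order of the occurrences in the rotation of G.  At f ∈ F_b the
  -- rotation runs along the boundary walk, oriented consistently with the
  -- embedding: the successor of occurrence x is the previous
  -- occurrence on the walk.
  RotB : BDart → BDart → Set
  RotB (vf x) (vf y) = BOcc x × NextRotOcc x y
  RotB (fv x) (fv y) = BOcc x × NextOcc y x
  RotB (vf x) (fv y) = ⊥
  RotB (fv x) (vf y) = ⊥

  FollowB : BDart → BDart → Set
  FollowB e e' = RotB (revB e) e'

  GbFace : ℕ → Set
  GbFace k = Σ (Fin k → BDart) λ s →
             (∀ i j → s i ≡ s j → i ≡ j) × (∀ i → FollowB (s i) (s (cycSucc i)))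

  -- z lies in the angle of G-bar_b at tail x that starts at the G_b-edge of
  -- occurrence x (i.e. z = rot^j x with no G_b-edge before it)
  InAngleAfter : Fin (d G) → Fin (d G) → Set
  InAngleAfter x z = ∃ λ j → iter (rot G) j x ≡ z
                     × (∀ i → i < j → ¬ BOcc (iter (rot G) (suc i) x))

  -- the component of G - V_c containing c is inside the face F of G_b: some
  -- edge from that component to V_c lies in an angle of F (at a V_c vertex, F
  -- arrives by fv x and leaves by the next G_b-edge in rotation after vf x)
  Inside : {k : ℕ} → GbFace k → Fin (n G) → Set
  Inside {k} (s , _) c = ∃ λ (i : Fin k) → ∃ λ x → ∃ λ z →
    s i ≡ fv x × InAngleAfter x z × ReachOut c (head G z)

  -- F_C ≠ ∅ for the component C of c: some face not in F_b has all its
  -- boundary vertices in C ∪ V_c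
  FCNonempty : Fin (n G) → Set
  FCNonempty c = ∃ λ z → ¬ InFb z ×
    (∀ w → SameFace G z w → tail G w ∈ Vc ⊎ ReachOut c (tail G w))

module Submission where

open import Defs
open import Data.Fin using (Fin; zero; suc; toℕ)
open import Data.Fin.Subset using (Subset; _∈_; _∉_)
open import Data.Fin.Properties using (pigeonhole; _≟_)
open import Data.Nat as ℕ using (zero; suc; z≤n; s≤s)
open import Data.Nat.Properties using (n<1+n; m<n⇒m<1+n)
open import Data.Product using (Σ; ∃; _×_; _,_; proj₁)
open import Data.Sum using (_⊎_; inj₁; inj₂)
open import Data.Empty using (⊥-elim)
open import Relation.Nullary using (¬_; yes; no)
open import Relation.Binary.PropositionalEquality

-- A face {vf x, fv y} of size 2 of G_b says that, at v = tail y ∈ V_c, the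
-- occurrence x is both the next V_c-occurrence after y on the face of y and the
-- next G_b-occurrence after y around v. The darts of the angle of G-bar_b at v
-- after y lie, apart from y, on faces of G outside F_b; walking around such a
-- face from its V_c corner never meets V_c again, so the heads of consecutive
-- darts of the angle are joined outside V_c. Hence every component inside the
-- face is the one of head y ∉ V_c. Dual simplicity forces the angle to contain
-- a dart rot y other than y, and the face of rot y lies in F_C.

module Properties (G : EmbeddedGraph) (E : IsEmbeddedGraph G) where
  open IsEmbeddedGraph E

  module _ {P : Fin (n G) → Set} where

    infixr 5 _++ʷ_

    _++ʷ_ : ∀ {u v w} → Walk G P u v → Walk G P v w → Walk G P u w
    here _     ++ʷ r = r
    step x p q ++ʷ r = step x p (q ++ʷ r)

    snocʷ : ∀ {u} (x : Fin (d G)) → Walk G P u (tail G x) → P (head G x) →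
            Walk G P u (head G x)
    snocʷ x (here p)     px = step x p (here px)
    snocʷ x (step y p q) px = step y p (snocʷ x q px)

    reverseʷ : ∀ {u v} → Walk G P u v → Walk G P v u
    reverseʷ (here p)     = here p
    reverseʷ (step x p q) =
      subst (Walk G P _) tail-rev-rev
        (snocʷ (rev G x) (reverseʷ q) (subst P (sym tail-rev-rev) p))
      where
      tail-rev-rev : head G (rev G x) ≡ tail G x
      tail-rev-rev = cong (tail G) (rev-invol x)

  tail-fnext : ∀ x → tail G (fnext G x) ≡ head G x
  tail-fnext x = rot-tail (rev G x)

  tail-iter-rot : ∀ j x → tail G (iter (rot G) j x) ≡ tail G x
  tail-iter-rot zero    x = refl
  tail-iter-rot (suc j) x = trans (rot-tail _) (tail-iter-rot j x)

  fnext-injective : ∀ {x y} → fnext G x ≡ fnext G y → x ≡ y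
  fnext-injective {x} {y} e =
    trans (sym (rev-invol x)) (trans (cong (rev G) (rot-inj _ _ e)) (rev-invol y))

  iter-fnext-periodic : ∀ x → ∃ λ p → iter (fnext G) (suc p) x ≡ x
  iter-fnext-periodic x
    with i , j , i<j , e ← pigeonhole (n<1+n (d G)) (λ i → iter (fnext G) (toℕ i) x)
    = cancel (toℕ i) (toℕ j) i<j e
    where
    cancel : ∀ i j → i ℕ.< j → iter (fnext G) i x ≡ iter (fnext G) j x →
             ∃ λ p → iter (fnext G) (suc p) x ≡ x
    cancel zero    (suc p) _         e = p , sym e
    cancel (suc i) (suc j) (s≤s i<j) e = cancel i j i<j (fnext-injective e)

  rot-sameFace-rev : ∀ x → SameFace G (rot G x) (rev G x)
  rot-sameFace-rev x with p , e ← iter-fnext-periodic (rot G x) =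
    p , fnext-injective (trans e (sym (cong (rot G) (rev-invol x))))

  module WithCutset (Vc : Subset (n G)) where

    nonBoundary-tail∉ : ∀ {a w} → tail G a ∈ Vc → ¬ InFb G Vc a →
                        SameFace G a w → w ≢ a → tail G w ∉ Vc
    nonBoundary-tail∉ ta a∉Fb a~w w≢a tw =
      a∉Fb (_ , _ , (zero , refl) , a~w , (λ a≡w → w≢a (sym a≡w)) , ta , tw)

    nonBoundary-reach : ∀ {a} → tail G a ∈ Vc → ¬ InFb G Vc a →
                        ∀ w → SameFace G a w → w ≡ a ⊎ ReachOut G Vc (head G a) (tail G w)
    nonBoundary-reach {a} ta a∉Fb w (m , refl) = go m
      where
      go : ∀ m → iter (fnext G) m a ≡ a ⊎ ReachOut G Vc (head G a) (tail G (iter (fnext G) m a))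
      go zero = inj₁ refl
      go (suc m) with fnext G (iter (fnext G) m a) ≟ a
      ... | yes e = inj₁ e
      ... | no ne = inj₂ (subst (ReachOut G Vc (head G a)) (sym (tail-fnext _)) (extend (go m)))
        where
        head∉ : head G (iter (fnext G) m a) ∉ Vc
        head∉ = subst (_∉ Vc) (tail-fnext _) (nonBoundary-tail∉ ta a∉Fb (suc m , refl) ne)

        extend : iter (fnext G) m a ≡ a ⊎ ReachOut G Vc (head G a) (tail G (iter (fnext G) m a)) →
                 ReachOut G Vc (head G a) (head G (iter (fnext G) m a))
        extend (inj₁ e) = subst (λ b → ReachOut G Vc (head G a) (head G b)) (sym e)
                            (here (subst (λ b → head G b ∉ Vc) e head∉))
        extend (inj₂ r) = snocʷ _ r head∉

    nonBoundary-FCNonempty : ∀ {a c} → tail G a ∈ Vc → ¬ InFb G Vc a →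
                             ReachOut G Vc c (head G a) → FCNonempty G Vc c
    nonBoundary-FCNonempty {a} {c} ta a∉Fb r = a , a∉Fb , reach
      where
      reach : ∀ w → SameFace G a w → tail G w ∈ Vc ⊎ ReachOut G Vc c (tail G w)
      reach w a~w with nonBoundary-reach ta a∉Fb w a~w
      ... | inj₁ w≡a = inj₁ (subst (λ b → tail G b ∈ Vc) (sym w≡a) ta)
      ... | inj₂ r′  = inj₂ (r ++ʷ r′)

    module _ (no-loop : ∀ x → tail G x ≢ head G x) where

      -- rev x lies on the face of rot x, whose walk from its V_c corner ends at head x.
      nonBoundary-rot-reach : ∀ {x} → tail G (rot G x) ∈ Vc → ¬ InFb G Vc (rot G x) →
                              ReachOut G Vc (head G (rot G x)) (head G x)
      nonBoundary-rot-reach {x} tr r∉Fb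
        with nonBoundary-reach tr r∉Fb (rev G x) (rot-sameFace-rev x)
      ... | inj₂ r = r
      ... | inj₁ e = ⊥-elim (no-loop x (sym (trans (cong (tail G) e) (rot-tail x))))

      angle-reach : ∀ {y z} → tail G y ∈ Vc → head G y ∉ Vc → InAngleAfter G Vc y z →
                    ReachOut G Vc (head G z) (head G y)
      angle-reach {y} ty hy (j , refl , no-occ) = go j no-occ
        where
        go : ∀ j → (∀ i → i ℕ.< j → ¬ BOcc G Vc (iter (rot G) (suc i) y)) →
             ReachOut G Vc (head G (iter (rot G) j y)) (head G y)
        go zero    _      = here hy
        go (suc j) no-occ =
          nonBoundary-rot-reach tj (λ fb → no-occ j (n<1+n j) (tj , fb))
            ++ʷ go j (λ i i<j → no-occ i (m<n⇒m<1+n i<j))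
          where
          tj : tail G (iter (rot G) (suc j) y) ∈ Vc
          tj = subst (_∈ Vc) (sym (tail-iter-rot (suc j) y)) ty

      nextOcc-head∉ : ∀ {y x} → NextOcc G Vc y x → tail G x ≡ tail G y → head G y ∉ Vc
      nextOcc-head∉ {y} (zero  , refl , _ , _) tx≡ty =
        ⊥-elim (no-loop y (trans (sym tx≡ty) (tail-fnext y)))
      nextOcc-head∉ {y} (suc k , _ , _ , between∉) _ =
        subst (_∉ Vc) (tail-fnext y) (between∉ zero (s≤s z≤n))

    nextRotOcc-tail : ∀ {y x} → NextRotOcc G Vc y x → tail G x ≡ tail G y
    nextRotOcc-tail {y} (k , refl , _) = tail-iter-rot (suc k) y

    nextRotOcc-rot : ∀ {y x} → NextRotOcc G Vc y x → rot G y ≢ x → ¬ BOcc G Vc (rot G y)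
    nextRotOcc-rot (zero  , e , _)          ne = ⊥-elim (ne e)
    nextRotOcc-rot (suc k , _ , _ , no-occ) _  = no-occ zero (s≤s z≤n)

    -- rot y = fnext^(k+1) y = rot (rev (fnext^k y)) would put rev y on the face of y.
    nextOcc-rot≢ : (∀ x → ¬ SameFace G x (rev G x)) →
                   ∀ {y x} → NextOcc G Vc y x → rot G y ≢ x
    nextOcc-rot≢ no-dual-loop {y} (k , refl , _) e =
      no-dual-loop y (k , sym (trans (cong (rev G) y≡) (rev-invol _)))
      where
      y≡ : y ≡ rev G (iter (fnext G) k y)
      y≡ = rot-inj _ _ e

    record Digon (f : GbFace G Vc 2) : Set where
      field
        index      : Fin 2
        y x        : Fin (d G)
        fv-at      : proj₁ f index ≡ fv y
        fv-unique  : ∀ j x′ → proj₁ f j ≡ fv x′ → x′ ≡ y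
        tail-y∈Vc  : tail G y ∈ Vc
        nextOcc    : NextOcc G Vc y x
        nextRotOcc : NextRotOcc G Vc y x

    gbFace₂-digon : (f : GbFace G Vc 2) → Digon f
    gbFace₂-digon f@(s , _ , follows) =
      digon (s zero) (s (suc zero)) refl refl (follows zero) (follows (suc zero))
      where
      fv-injective : ∀ {a b} → _≡_ {A = BDart G Vc} (fv a) (fv b) → a ≡ b
      fv-injective refl = refl

      digon : ∀ e₀ e₁ → s zero ≡ e₀ → s (suc zero) ≡ e₁ →
              FollowB G Vc e₀ e₁ → FollowB G Vc e₁ e₀ → Digon f
      digon (vf x) (fv y) s₀ s₁ (_ , occ) ((ty , _) , rotOcc) =
        record { index = suc zero ; y = y ; x = x ; fv-at = s₁ ; fv-unique = unique
               ; tail-y∈Vc = ty ; nextOcc = occ ; nextRotOcc = rotOcc }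
        where
        unique : ∀ j x′ → s j ≡ fv x′ → x′ ≡ y
        unique zero       _ e with () ← trans (sym s₀) e
        unique (suc zero) _ e = fv-injective (trans (sym e) s₁)
      digon (fv y) (vf x) s₀ s₁ ((ty , _) , rotOcc) (_ , occ) =
        record { index = zero ; y = y ; x = x ; fv-at = s₀ ; fv-unique = unique
               ; tail-y∈Vc = ty ; nextOcc = occ ; nextRotOcc = rotOcc }
        where
        unique : ∀ j x′ → s j ≡ fv x′ → x′ ≡ y
        unique zero       _ e = fv-injective (trans (sym e) s₀)
        unique (suc zero) _ e with () ← trans (sym s₁) e

lemma4 : (G : EmbeddedGraph) → IsEmbeddedGraph G → SimpleGraph G → DualSimple G →
         (Vc : Subset (n G)) → Cutset G Vc → (f : GbFace G Vc 2) →
         Σ (Fin (n G)) λ c → c ∉ Vc × Inside G Vc f c ×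
           ((c′ : Fin (n G)) → Inside G Vc f c′ → ReachOut G Vc c c′) ×
           FCNonempty G Vc c
lemma4 G E (no-loop , _) (no-dual-loop , _) Vc _ f =
  head G y , hy∉ , inside , unique , fc
  where
  open Properties G E
  open WithCutset Vc
  open Digon (gbFace₂-digon f)

  hy∉ : head G y ∉ Vc
  hy∉ = nextOcc-head∉ no-loop nextOcc (nextRotOcc-tail nextRotOcc)

  inside : Inside G Vc f (head G y)
  inside = index , y , y , fv-at , (zero , refl , λ _ ()) , here hy∉

  unique : ∀ c′ → Inside G Vc f c′ → ReachOut G Vc (head G y) c′
  unique c′ (j , x′ , z , e , angle , r) with refl ← fv-unique j x′ e =
    reverseʷ (r ++ʷ angle-reach no-loop tail-y∈Vc hy∉ angle)

  tail-rot-y∈Vc : tail G (rot G y) ∈ Vc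
  tail-rot-y∈Vc = subst (_∈ Vc) (sym (IsEmbeddedGraph.rot-tail E y)) tail-y∈Vc

  rot-y∉Fb : ¬ InFb G Vc (rot G y)
  rot-y∉Fb fb = nextRotOcc-rot nextRotOcc
    (nextOcc-rot≢ no-dual-loop nextOcc) (tail-rot-y∈Vc , fb)

  fc : FCNonempty G Vc (head G y)
  fc = nonBoundary-FCNonempty tail-rot-y∈Vc rot-y∉Fb
         (reverseʷ (nonBoundary-rot-reach no-loop tail-rot-y∈Vc rot-y∉Fb))
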